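{- Let $\Omega$ be a finite list of rules from $\{\rho^+,\rho^-,\pi^+,\pi^-,\mathfrak{4},\lambda,\mathsf{J}\}$ (atomic, replicative, decreasing and modal rules). For all modal trees $\mathtt{T},\mathtt{S}$: if $\mathtt{T}\hookrightarrow^{\sigma*}\circ\hookrightarrow^{\Omega}\mathtt{S}$, then $\mathtt{T}\hookrightarrow^{\Omega}\circ\hookrightarrow^{\sigma*}\mathtt{S}$.
   Context: Modal trees: recursively, pairs $\langle\Delta;\Gamma\rangle$ with $\Delta$ a finite list of propositional variables and $\Gamma$ a finite list of pairs $(\alpha,\mathtt{S})$, $\alpha<\omega$, $\mathtt{S}$ a modal tree. Positions: $\mathrm{Pos}(\langle\Delta;\varnothing\rangle)=\{\epsilon\}$; $\mathrm{Pos}(\langle\Delta;[(\alpha_1,\mathtt{S}_1),\dots,(\alpha_n,\mathtt{S}_n)]\rangle)=\{\epsilon\}\cup\bigcup_{i=1}^n\{i\mathbf{k}\mid\mathbf{k}\in\mathrm{Pos}(\mathtt{S}_i)\}$. Subtree: $\mathtt{T}|_\epsilon=\mathtt{T}$, $\mathtt{T}|_{i\mathbf{r}}=\mathtt{S}_i|_{\mathbf{r}}$. Replacement: $\mathtt{T}[\mathtt{S}]_\epsilon=\mathtt{S}$, $\mathtt{T}[\mathtt{S}]_{i\mathbf{r}}$ is $\mathtt{T}$ with its $i$-th child $\mathtt{S}_i$ replaced by $\mathtt{S}_i[\mathtt{S}]_{\mathbf{r}}$ (same edge label). List operations, for $0<i,j\le|\Gamma|$: $\#_i\Gamma$ is the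 $i$-th element; $\Gamma^{ -i}$ deletes it; $\Gamma^{+i}=(\#_i\Gamma)\frown\Gamma$; $\Gamma[x]_i$ replaces the $i$-th element by $x$; $\Gamma^{i\leftrightarrow j}$ swaps the $i$-th and $j$-th elements; similarly $\Delta^{ -n},\Delta^{+n}$. Rules: for a modal tree $\mathtt{T}$, $\mathbf{k}\in\mathrm{Pos}(\mathtt{T})$ with $\mathtt{T}|_\mathbf{k}=\langle\Delta;\Gamma\rangle$: ($\rho^+$) $\mathtt{T}\hookrightarrow^{\rho^+}\mathtt{T}[\langle\Delta^{+i};\Gamma\rangle]_\mathbf{k}$, $0<i\le|\Delta|$; ($\rho^-$) $\mathtt{T}\hookrightarrow^{\rho^- }\mathtt{T}[\langle\Delta^{ -i};\Gamma\rangle]_\mathbf{k}$; ($\sigma$) $\mathtt{T}\hookrightarrow^{\sigma}\mathtt{T}[\langle\Delta;\Gamma^{i\leftrightarrow j}\rangle]_\mathbf{k}$, $i\neq j$; ($\pi^+$) $\mathtt{T}\hookrightarrow^{\pi^+}\mathtt{T}[\langle\Delta;\Gamma^{+i}\rangle]_\mathbf{k}$; ($\pi^-$) $\mathtt{T}\hookrightarrow^{\pi^- }\mathtt{T}[\langle\Delta;\Gamma^{ -i}\rangle]_\mathbf{k}$; ($\mathfrak{4}$) if $\#_i\Gamma=(\beta,\langle\tilde\Delta;\tilde\Gamma\rangle)$ and $\#_j\tilde\Gamma=(\beta,\mathtt{S})$, then $\mathtt{T}\hookrightarrow^{\mathfrak{4}}\mathtt{T}[\langle\Delta;\Gamma[(\beta,\mathtt{S})]_i\rangle]_\mathbf{k}$;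 ($\lambda$) if $\#_i\Gamma=(\alpha,\mathtt{S})$ and $\alpha>\beta$, then $\mathtt{T}\hookrightarrow^{\lambda}\mathtt{T}[\langle\Delta;\Gamma[(\beta,\mathtt{S})]_i\rangle]_\mathbf{k}$; ($\mathsf{J}$) if $i\ne j$, $\#_i\Gamma=(\alpha,\langle\tilde\Delta;\tilde\Gamma\rangle)$, $\#_j\Gamma=(\beta,\mathtt{S})$, $\alpha>\beta$, then $\mathtt{T}\hookrightarrow^{\mathsf{J}}\mathtt{T}[\langle\Delta;(\Gamma[(\alpha,\langle\tilde\Delta;\tilde\Gamma\frown(\beta,\mathtt{S})\rangle)]_i)^{ -j}\rangle]_\mathbf{k}$. Notation: for a list $\Omega$ of rules, $\mathtt{T}\hookrightarrow^{\Omega}\mathtt{S}$ means $\mathtt{S}=\mathtt{T}$ if $\Omega=\varnothing$, and $\mathtt{T}\hookrightarrow^{\mu}\mathtt{U}\hookrightarrow^{\hat\Omega}\mathtt{S}$ for some $\mathtt{U}$ if $\Omega=\mu\frown\hat\Omega$; $\mathtt{T}\hookrightarrow^{X}\circ\hookrightarrow^{Y}\mathtt{S}$ means there is $\mathtt{U}$ with $\mathtt{T}\hookrightarrow^{X}\mathtt{U}\hookrightarrow^{Y}\mathtt{S}$; $\hookrightarrow^{\sigma*}$ means zero or more applications of $\sigma$. -}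

module Defs where

open import Data.Nat using (ℕ; zero; suc; _<_)
open import Data.List using (List; []; _∷_; _++_; [_])
open import Data.Maybe using (Maybe; just; nothing)
open import Data.Product using (_×_; _,_)
open import Relation.Binary.PropositionalEquality using (_≡_; _≢_)

PVar : Set
PVar = ℕ

-- Modal trees ⟨Δ;Γ⟩: Δ a list of propositional variables,
-- Γ a list of labelled children (α , S) with α < ω.
data Tree : Set where
  node : List PVar → List (ℕ × Tree) → Tree

-- List operations, with 0-based indices (the paper uses 1-based ones).
-- get xs i = just (#_{i+1} xs) when the index is in range.
get : {A : Set} → List A → ℕ → Maybe A
get []       _       = nothing
get (x ∷ xs) zero    = just x
get (x ∷ xs) (suc i) = get xs i

del : {A : Set} → ℕ → List A → List A
del _       []       = []
del zero    (x ∷ xs) = xs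
del (suc i) (x ∷ xs) = x ∷ del i xs

upd : {A : Set} → ℕ → A → List A → List A
upd _       _ []       = []
upd zero    y (x ∷ xs) = y ∷ xs
upd (suc i) y (x ∷ xs) = x ∷ upd i y xs

data Rule : Set where
  ρ⁺ ρ⁻ σ π⁺ π⁻ 𝟜 ƛ 𝖩 : Rule

data Local : Rule → Tree → Tree → Set where
  ρ⁺-step : ∀ {Δ Γ i p} → get Δ i ≡ just p →
            Local ρ⁺ (node Δ Γ) (node (p ∷ Δ) Γ)
  ρ⁻-step : ∀ {Δ Γ i p} → get Δ i ≡ just p →
            Local ρ⁻ (node Δ Γ) (node (del i Δ) Γ)
  σ-step  : ∀ {Δ Γ i j x y} → i ≢ j → get Γ i ≡ just x → get Γ j ≡ just y →
            Local σ (node Δ Γ) (node Δ (upd j x (upd i y Γ)))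
  π⁺-step : ∀ {Δ Γ i x} → get Γ i ≡ just x →
            Local π⁺ (node Δ Γ) (node Δ (x ∷ Γ))
  π⁻-step : ∀ {Δ Γ i x} → get Γ i ≡ just x →
            Local π⁻ (node Δ Γ) (node Δ (del i Γ))
  𝟜-step  : ∀ {Δ Γ i j β Δ' Γ' S} →
            get Γ i ≡ just (β , node Δ' Γ') → get Γ' j ≡ just (β , S) →
            Local 𝟜 (node Δ Γ) (node Δ (upd i (β , S) Γ))
  ƛ-step  : ∀ {Δ Γ i α β S} → get Γ i ≡ just (α , S) → β < α →
            Local ƛ (node Δ Γ) (node Δ (upd i (β , S) Γ))
  𝖩-step  : ∀ {Δ Γ i j α β Δ' Γ' S} → i ≢ j →
            get Γ i ≡ just (α , node Δ' Γ') → get Γ j ≡ just (β , S) → β < α →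
            Local 𝖩 (node Δ Γ) (node Δ (del j (upd i (α , node Δ' (Γ' ++ [ (β , S) ])) Γ)))

-- T ↪^r S : application of rule r at some position k of T, i.e.
-- T[U]_k where T|_k ↪ U at the root (replacement defined recursively on positions).
data Step (r : Rule) : Tree → Tree → Set where
  here  : ∀ {T S} → Local r T S → Step r T S
  there : ∀ {Δ Γ i α S₁ S₂} → get Γ i ≡ just (α , S₁) → Step r S₁ S₂ →
          Step r (node Δ Γ) (node Δ (upd i (α , S₂) Γ))

data Steps : List Rule → Tree → Tree → Set where
  done : ∀ {T} → Steps [] T T
  step : ∀ {μ Ω T U S} → Step μ T U → Steps Ω U S → Steps (μ ∷ Ω) T S

{-# OPTIONS --safe #-}
-- Call two trees equivalent when one arises from the other by reordering the
-- children of its nodes. A σ-step yields an equivalent tree, and equivalent trees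
-- are connected by σ-steps. Every other rule sees the children of a node only
-- through their labels and subtrees, never through their order, so a step from a
-- tree can be replayed from any equivalent tree and lands in an equivalent tree.
-- Hence σ-steps can be pushed past the rules of Ω one at a time.
module Submission where

open import Defs
open import Data.List using (List; []; _∷_; _++_; [_])
open import Data.List.Relation.Unary.All using (All; []; _∷_)
import Data.List.Relation.Unary.Any as Any
open import Data.List.Membership.Propositional using (_∈_)
open import Data.List.Relation.Binary.Permutation.Propositional
open import Data.List.Relation.Binary.Permutation.Propositional.Properties
  using (∈-resp-↭; drop-∷; ++⁺ʳ)
open import Data.Maybe using (just)
open import Data.Nat using (ℕ; zero; suc)
open import Data.Nat.Properties using (suc-injective)
open import Data.Product using (∃; ∃₂; _×_; _,_)
open import Data.Empty using (⊥-elim)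
open import Function using (_∘_)
open import Relation.Binary.PropositionalEquality
  using (_≡_; _≢_; refl; sym; cong; subst)
open import Relation.Binary.Construct.Closure.ReflexiveTransitive
  using (Star; ε; _◅_; _◅◅_; gmap)

module _ {A : Set} where

  get⇒∈ : ∀ {xs : List A} {k x} → get xs k ≡ just x → x ∈ xs
  get⇒∈ {_ ∷ _} {zero}  refl = Any.here refl
  get⇒∈ {_ ∷ _} {suc k} g    = Any.there (get⇒∈ g)

  ∈⇒get : ∀ {xs : List A} {x} → x ∈ xs → ∃ λ k → get xs k ≡ just x
  ∈⇒get (Any.here refl) = zero , refl
  ∈⇒get (Any.there x∈)  = let (k , g) = ∈⇒get x∈ in suc k , g

  get-upd-≢ : ∀ {xs : List A} {i j y} → i ≢ j → get (upd i y xs) j ≡ get xs j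
  get-upd-≢ {[]}                      i≢j = refl
  get-upd-≢ {_ ∷ _}  {zero}  {zero}  i≢j = ⊥-elim (i≢j refl)
  get-upd-≢ {_ ∷ _}  {zero}  {suc j} i≢j = refl
  get-upd-≢ {_ ∷ _}  {suc i} {zero}  i≢j = refl
  get-upd-≢ {_ ∷ xs} {suc i} {suc j} i≢j = get-upd-≢ {xs} (i≢j ∘ cong suc)

  upd-get-id : ∀ {xs : List A} {k x} → get xs k ≡ just x → upd k x xs ≡ xs
  upd-get-id {_ ∷ _} {zero}  refl = refl
  upd-get-id {y ∷ _} {suc k} g    = cong (y ∷_) (upd-get-id g)

  get⇒↭∷del : ∀ {xs : List A} {k x} → get xs k ≡ just x → xs ↭ x ∷ del k xs
  get⇒↭∷del {_ ∷ _} {zero}  refl = refl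
  get⇒↭∷del {y ∷ _} {suc k} {x} g = trans (prep y (get⇒↭∷del g)) (swap y x refl)

  upd↭∷del : ∀ {xs : List A} {k x} y → get xs k ≡ just x → upd k y xs ↭ y ∷ del k xs
  upd↭∷del {_ ∷ _} {zero}  y refl = refl
  upd↭∷del {z ∷ _} {suc k} y g    = trans (prep z (upd↭∷del y g)) (swap z y refl)

  -- Deleting position j moves every other position i to a position i* of the
  -- shorter list; the two lemmas are the two directions of this reindexing.
  del-upd-reindex : ∀ {xs : List A} {i j a} → i ≢ j → get xs i ≡ just a →
    ∃ λ i* → get (del j xs) i* ≡ just a × (∀ c → del j (upd i c xs) ≡ upd i* c (del j xs))
  del-upd-reindex {_ ∷ _} {zero}  {zero}  i≢j g    = ⊥-elim (i≢j refl)
  del-upd-reindex {_ ∷ _} {zero}  {suc j} i≢j refl = zero , refl , λ c → refl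
  del-upd-reindex {_ ∷ _} {suc i} {zero}  i≢j g    = i , g , λ c → refl
  del-upd-reindex {x ∷ xs} {suc i} {suc j} i≢j g =
    let (i* , g* , eq) = del-upd-reindex {xs} (i≢j ∘ cong suc) g
    in suc i* , g* , cong (x ∷_) ∘ eq

  del-upd-reindex⁻ : ∀ {xs : List A} {i* j a} → get (del j xs) i* ≡ just a →
    ∃ λ i → i ≢ j × get xs i ≡ just a × (∀ c → del j (upd i c xs) ≡ upd i* c (del j xs))
  del-upd-reindex⁻ {_ ∷ _} {i*}     {zero}  g    = suc i* , (λ ()) , g , λ c → refl
  del-upd-reindex⁻ {_ ∷ _} {zero}   {suc j} refl = zero , (λ ()) , refl , λ c → refl
  del-upd-reindex⁻ {x ∷ xs} {suc i*} {suc j} g   =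
    let (i , i≢j , g′ , eq) = del-upd-reindex⁻ {xs} {i*} {j} g
    in suc i , i≢j ∘ suc-injective , g′ , cong (x ∷_) ∘ eq

  upd-swap-↭ : ∀ {xs : List A} {i j x y} → i ≢ j → get xs i ≡ just x → get xs j ≡ just y →
               xs ↭ upd j x (upd i y xs)
  upd-swap-↭ {xs} {i} {j} {x} {y} i≢j gi gj with del-upd-reindex {xs} {i} {j} i≢j gi
  ... | i* , gi* , eq = begin
    xs                          ↭⟨ get⇒↭∷del gj ⟩
    y ∷ del j xs                ↭⟨ prep y (get⇒↭∷del gi*) ⟩
    y ∷ x ∷ del i* (del j xs)   ↭⟨ swap y x refl ⟩
    x ∷ y ∷ del i* (del j xs)   ↭⟨ prep x (↭-sym (upd↭∷del y gi*)) ⟩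
    x ∷ upd i* y (del j xs)     ≡⟨ cong (x ∷_) (sym (eq y)) ⟩
    x ∷ del j (upd i y xs)      ↭⟨ ↭-sym (upd↭∷del x gj′) ⟩
    upd j x (upd i y xs)        ∎
    where
    open PermutationReasoning
    gj′ : get (upd i y xs) j ≡ just y
    gj′ = subst (_≡ just y) (sym (get-upd-≢ {xs} i≢j)) gj

  ↭-get : ∀ {xs ys : List A} {k x} → xs ↭ ys → get ys k ≡ just x →
          ∃ λ k′ → get xs k′ ≡ just x
  ↭-get p g = ∈⇒get (∈-resp-↭ (↭-sym p) (get⇒∈ g))

  ↭-del : ∀ {xs ys : List A} {k x} → xs ↭ ys → get ys k ≡ just x →
          ∃ λ k′ → get xs k′ ≡ just x × del k′ xs ↭ del k ys
  ↭-del p g =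
    let (k′ , g′) = ↭-get p g
    in k′ , g′ , drop-∷ (trans (↭-sym (get⇒↭∷del g′)) (trans p (get⇒↭∷del g)))

  ↭-upd : ∀ {xs ys : List A} {k x} → xs ↭ ys → get ys k ≡ just x →
          ∃ λ k′ → get xs k′ ≡ just x × (∀ y → upd k′ y xs ↭ upd k y ys)
  ↭-upd p g =
    let (k′ , g′ , d) = ↭-del p g
    in k′ , g′ , λ y → trans (upd↭∷del y g′) (trans (prep y d) (↭-sym (upd↭∷del y g)))

  ↭-del-upd : ∀ {xs ys : List A} {i j a b} → xs ↭ ys → i ≢ j →
              get ys i ≡ just a → get ys j ≡ just b →
              ∃₂ λ i′ j′ → i′ ≢ j′ × get xs i′ ≡ just a × get xs j′ ≡ just b ×
                (∀ c → del j′ (upd i′ c xs) ↭ del j (upd i c ys))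
  ↭-del-upd {xs} {ys} {i} {j} p i≢j gi gj =
    let (j′ , gj′ , d)           = ↭-del p gj
        (i* , gi* , eq)          = del-upd-reindex {ys} {i} {j} i≢j gi
        (i′* , gi′* , u)         = ↭-upd d gi*
        (i′ , i′≢j′ , gi′ , eq′) = del-upd-reindex⁻ {xs} {i′*} {j′} gi′*
    in i′ , j′ , i′≢j′ , gi′ , gj′ , λ c →
         trans (↭-reflexive (eq′ c)) (trans (u c) (↭-reflexive (sym (eq c))))

Children : Set
Children = List (ℕ × Tree)

mutual
  data _≈_ : Tree → Tree → Set where
    reorder : ∀ {Δ Γ Γ′ Γ″} → Γ ≋ Γ′ → Γ′ ↭ Γ″ → node Δ Γ ≈ node Δ Γ″

  data _≋_ : Children → Children → Set where
    []  : [] ≋ []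
    _∷_ : ∀ {α S S′ Γ Γ′} → S ≈ S′ → Γ ≋ Γ′ → ((α , S) ∷ Γ) ≋ ((α , S′) ∷ Γ′)

mutual
  ≈-refl : ∀ T → T ≈ T
  ≈-refl (node Δ Γ) = reorder (≋-refl Γ) refl

  ≋-refl : ∀ Γ → Γ ≋ Γ
  ≋-refl []            = []
  ≋-refl ((α , S) ∷ Γ) = ≈-refl S ∷ ≋-refl Γ

≋-get : ∀ {Γ Γ′ k α S′} → Γ ≋ Γ′ → get Γ′ k ≡ just (α , S′) →
        ∃ λ S → get Γ k ≡ just (α , S) × S ≈ S′
≋-get {k = zero}  (S≈S′ ∷ _) refl = _ , refl , S≈S′
≋-get {k = suc k} (_ ∷ Γ≋Γ′) g    = ≋-get Γ≋Γ′ g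

≋-del : ∀ {Γ Γ′} k → Γ ≋ Γ′ → del k Γ ≋ del k Γ′
≋-del k       []            = []
≋-del zero    (_ ∷ Γ≋Γ′)    = Γ≋Γ′
≋-del (suc k) (S≈S′ ∷ Γ≋Γ′) = S≈S′ ∷ ≋-del k Γ≋Γ′

≋-upd : ∀ {Γ Γ′ S S′} k {α} → Γ ≋ Γ′ → S ≈ S′ → upd k (α , S) Γ ≋ upd k (α , S′) Γ′
≋-upd k       []          _ = []
≋-upd zero    (_ ∷ Γ≋Γ′)  e = e ∷ Γ≋Γ′
≋-upd (suc k) (e′ ∷ Γ≋Γ′) e = e′ ∷ ≋-upd k Γ≋Γ′ e

≋-++ : ∀ {Γ₁ Γ₁′ Γ₂ Γ₂′} → Γ₁ ≋ Γ₁′ → Γ₂ ≋ Γ₂′ → (Γ₁ ++ Γ₂) ≋ (Γ₁′ ++ Γ₂′)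
≋-++ []      q = q
≋-++ (e ∷ p) q = e ∷ ≋-++ p q

data AtRoot (R : Children → Children → Set) : Tree → Tree → Set where
  children : ∀ {Δ Γ Γ′} → R Γ Γ′ → AtRoot R (node Δ Γ) (node Δ Γ′)

AtRoot-≋-↭⇒≈ : ∀ {S U T} → AtRoot _≋_ S U → AtRoot _↭_ U T → S ≈ T
AtRoot-≋-↭⇒≈ (children p) (children q) = reorder p q

σ⇒≈ : ∀ {T T′} → Step σ T T′ → T ≈ T′
σ⇒≈ (here (σ-step i≢j gi gj)) = reorder (≋-refl _) (upd-swap-↭ i≢j gi gj)
σ⇒≈ (there {Γ = Γ} {i} {α} {S₁} {S₂} g s) =
  reorder (subst (_≋ upd i (α , S₂) Γ) (upd-get-id g) (≋-upd i (≋-refl Γ) (σ⇒≈ s))) refl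

consChild : ℕ × Tree → Tree → Tree
consChild x (node Δ Γ) = node Δ (x ∷ Γ)

σ-consChild : ∀ {x T T′} → Step σ T T′ → Step σ (consChild x T) (consChild x T′)
σ-consChild (here (σ-step {i = i} {j} i≢j gi gj)) =
  here (σ-step {i = suc i} {suc j} (i≢j ∘ suc-injective) gi gj)
σ-consChild (there {i = i} g s) = there {i = suc i} g s

σ*-consChild : ∀ {x T T′} → Star (Step σ) T T′ → Star (Step σ) (consChild x T) (consChild x T′)
σ*-consChild {x} = gmap (consChild x) σ-consChild

σ*-head : ∀ {Δ α Γ S S′} → Star (Step σ) S S′ →
          Star (Step σ) (node Δ ((α , S) ∷ Γ)) (node Δ ((α , S′) ∷ Γ))
σ*-head ε        = ε
σ*-head (s ◅ ss) = there {i = zero} refl s ◅ σ*-head ss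

↭⇒σ* : ∀ {Δ Γ Γ′} → Γ ↭ Γ′ → Star (Step σ) (node Δ Γ) (node Δ Γ′)
↭⇒σ* refl         = ε
↭⇒σ* (prep x p)   = σ*-consChild (↭⇒σ* p)
↭⇒σ* (swap x y p) =
  here (σ-step {i = 0} {1} (λ ()) refl refl) ◅ σ*-consChild (σ*-consChild (↭⇒σ* p))
↭⇒σ* (trans p q)  = ↭⇒σ* p ◅◅ ↭⇒σ* q

mutual
  ≈⇒σ* : ∀ {T T′} → T ≈ T′ → Star (Step σ) T T′
  ≈⇒σ* (reorder Γ≋Γ′ p) = ≋⇒σ* Γ≋Γ′ ◅◅ ↭⇒σ* p

  ≋⇒σ* : ∀ {Δ Γ Γ′} → Γ ≋ Γ′ → Star (Step σ) (node Δ Γ) (node Δ Γ′)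
  ≋⇒σ* []            = ε
  ≋⇒σ* (S≈S′ ∷ Γ≋Γ′) = σ*-head (≈⇒σ* S≈S′) ◅◅ σ*-consChild (≋⇒σ* Γ≋Γ′)

Local-↭ : ∀ {μ Δ Γ Γ′ T′} → μ ≢ σ → Γ ↭ Γ′ → Local μ (node Δ Γ′) T′ →
          ∃ λ T → Local μ (node Δ Γ) T × AtRoot _↭_ T T′
Local-↭ μ≢σ p (ρ⁺-step g)     = _ , ρ⁺-step g , children p
Local-↭ μ≢σ p (ρ⁻-step g)     = _ , ρ⁻-step g , children p
Local-↭ μ≢σ p (σ-step _ _ _)  = ⊥-elim (μ≢σ refl)
Local-↭ μ≢σ p (π⁺-step {x = x} g) =
  let (_ , g′) = ↭-get p g in _ , π⁺-step g′ , children (prep x p)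
Local-↭ μ≢σ p (π⁻-step g) =
  let (_ , g′ , d) = ↭-del p g in _ , π⁻-step g′ , children d
Local-↭ μ≢σ p (𝟜-step {β = β} {S = S} g g′) =
  let (_ , g″ , u) = ↭-upd p g in _ , 𝟜-step g″ g′ , children (u (β , S))
Local-↭ μ≢σ p (ƛ-step {β = β} {S = S} g β<α) =
  let (_ , g′ , u) = ↭-upd p g in _ , ƛ-step g′ β<α , children (u (β , S))
Local-↭ μ≢σ p (𝖩-step {α = α} {β} {Δ′} {Γ′} {S} i≢j gi gj β<α) =
  let (i′ , j′ , i′≢j′ , gi′ , gj′ , u) = ↭-del-upd p i≢j gi gj
  in _ , 𝖩-step i′≢j′ gi′ gj′ β<α , children (u (α , node Δ′ (Γ′ ++ [ (β , S) ])))

Local-≋ : ∀ {μ Δ Γ Γ′ T′} → μ ≢ σ → Γ ≋ Γ′ → Local μ (node Δ Γ′) T′ →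
          ∃ λ T → Local μ (node Δ Γ) T × AtRoot _≋_ T T′
Local-≋ μ≢σ e (ρ⁺-step g)    = _ , ρ⁺-step g , children e
Local-≋ μ≢σ e (ρ⁻-step g)    = _ , ρ⁻-step g , children e
Local-≋ μ≢σ e (σ-step _ _ _) = ⊥-elim (μ≢σ refl)
Local-≋ μ≢σ e (π⁺-step g) =
  let (_ , g′ , S≈S′) = ≋-get e g in _ , π⁺-step g′ , children (S≈S′ ∷ e)
Local-≋ μ≢σ e (π⁻-step {i = i} g) =
  let (_ , g′ , _) = ≋-get e g in _ , π⁻-step g′ , children (≋-del i e)
Local-≋ μ≢σ e (𝟜-step {i = i} gi gj) with ≋-get e gi
... | _ , gi′ , reorder e′ p =
  let (_ , gj′)        = ↭-get p gj
      (_ , gj″ , S≈S′) = ≋-get e′ gj′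
  in _ , 𝟜-step gi′ gj″ , children (≋-upd i e S≈S′)
Local-≋ μ≢σ e (ƛ-step {i = i} g β<α) =
  let (_ , g′ , S≈S′) = ≋-get e g in _ , ƛ-step g′ β<α , children (≋-upd i e S≈S′)
Local-≋ μ≢σ e (𝖩-step {i = i} {j} i≢j gi gj β<α) with ≋-get e gi | ≋-get e gj
... | _ , gi′ , reorder e′ p | _ , gj′ , S≈S′ =
  _ , 𝖩-step i≢j gi′ gj′ β<α ,
  children (≋-del j (≋-upd i e (reorder (≋-++ e′ (S≈S′ ∷ [])) (++⁺ʳ _ p))))

Step-≈ : ∀ {μ T T′ S′} → μ ≢ σ → T ≈ T′ → Step μ T′ S′ → ∃ λ S → Step μ T S × S ≈ S′
Step-≈ μ≢σ (reorder e p) (here l) =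
  let (_ , l′ , q) = Local-↭ μ≢σ p l
      (S , l″ , r) = Local-≋ μ≢σ e l′
  in S , here l″ , AtRoot-≋-↭⇒≈ r q
Step-≈ μ≢σ (reorder e p) (there g s) =
  let (_ , g′ , u)      = ↭-upd p g
      (_ , g″ , S₁≈S₁′) = ≋-get e g′
      (_ , s′ , S₂≈S₂′) = Step-≈ μ≢σ S₁≈S₁′ s
  in _ , there g″ s′ , reorder (≋-upd _ e S₂≈S₂′) (u _)

σ-Step-commute : ∀ {μ T U S} → μ ≢ σ → Step σ T U → Step μ U S →
                 ∃ λ V → Step μ T V × Star (Step σ) V S
σ-Step-commute μ≢σ t u =
  let (V , t′ , V≈S) = Step-≈ μ≢σ (σ⇒≈ t) u in V , t′ , ≈⇒σ* V≈S

σ*-Step-commute : ∀ {μ T U S} → μ ≢ σ → Star (Step σ) T U → Step μ U S →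
                  ∃ λ V → Step μ T V × Star (Step σ) V S
σ*-Step-commute μ≢σ ε        u = _ , u , ε
σ*-Step-commute μ≢σ (t ◅ ts) u =
  let (W , u′ , W↝S) = σ*-Step-commute μ≢σ ts u
      (V , u″ , V↝W) = σ-Step-commute μ≢σ t u′
  in V , u″ , V↝W ◅◅ W↝S

mainTheorem16 : (Ω : List Rule) → All (_≢ σ) Ω → (T S : Tree) →
    (∃ λ U → Star (Step σ) T U × Steps Ω U S) →
    ∃ λ U → Steps Ω T U × Star (Step σ) U S
mainTheorem16 []      []          T S (U , T↝U , done)                = T , done , T↝U
mainTheorem16 (_ ∷ Ω) (μ≢σ ∷ Ω≢σ) T S (U , T↝U , step {U = W} u us) =
  let (V , u′ , V↝W)  = σ*-Step-commute μ≢σ T↝U u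
      (X , us′ , X↝S) = mainTheorem16 Ω Ω≢σ V S (W , V↝W , us)
  in X , step u′ us′ , X↝S
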